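{- Let $\mathcal{X}$ be a connected $n$-premaniplex with base flag $x_0$, $N=\mathrm{Stab}_{\mathcal{C}^n}(x_0)$, and let $(\mathcal{Y},\eta)$ be an $(n,m)$-voltage operator that preserves connectivity, with base flag $y_0$ of $\mathcal{Y}$, $L=\mathrm{Stab}_{\mathcal{C}^m}(y_0)$, $\zeta:L\to\mathcal{C}^n$, $\zeta(\omega)=\eta(P_\omega(y_0))$, and $\mathcal{Z}_\upsilon=\mathcal{C}^n/\zeta(L\cap L^\upsilon)$ for $\upsilon\in\mathcal{C}^m$. If for every $\upsilon\in\mathcal{C}^m\setminus\mathrm{Norm}_{\mathcal{C}^m}(L)$ the premaniplex $\mathcal{X}$ does not cover $\mathcal{Z}_\upsilon$, then every automorphism of $\mathcal{X}\rtimes_\eta\mathcal{Y}$ is a lift of an automorphism of $\mathcal{Y}$.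
   Context: A graph may have multiple edges and semi-edges. An $n$-premaniplex is such a graph with edges coloured by $\{0,\dots,n-1\}$ so that every vertex (flag) is the starting point of exactly one dart of each colour, and whenever $|i-j|\ge2$ every alternating path of length 4 with colours $i,j$ is closed; $x^i$ is the end of the $i$-dart at $x$. $\mathcal{C}^n=\langle r_0,\dots,r_{n-1}\mid r_i^2=1,\ (r_ir_j)^2=1\ (|i-j|\ge2)\rangle$ acts on the left on flags by $r_ix=x^i$; $\mathrm{Stab}$ denotes stabilisers, $\mathrm{Norm}$ normalisers, and $H^\upsilon=\upsilon^{ -1}H\upsilon$. Homomorphisms of premaniplexes preserve all $i$-adjacencies; $\mathcal{X}$ covers $\mathcal{Z}$ if there is a surjective homomorphism $\mathcal{X}\to\mathcal{Z}$; automorphisms are bijective self-homomorphisms acting on the right. For $K\le\mathcal{C}^n$ the coset premaniplex $\mathcal{C}^n/K$ has flags the left cosets $\omega K$ with $i$-adjacency $\omega K\mapsto r_i\omega K$. For a flag $y$ of an $m$-premaniplex $\mathcal{Y}$ and $\omega\in\mathcal{C}^m$, $P_\omega(y)$ is the homotopy class of paths from $y$ whose successive colours $i_1,\dots,i_k$ satisfy $r_{i_k}\cdots r_{i_1}=\omega$ (homotopic iff same start and same element of $\mathcal{C}^m$); they end at $\omega y$; these form the fundamental groupoid $\Pi(\mathcal{Y})$. A voltage assignment $\eta:\Pi(\mathcal{Y})\to\mathcal{C}^n$ satisfies $\eta(W_1W_2)=\eta(W_2)\eta(W_1)$; $(\mathcal{Y},\eta)$ is an $(n,m)$-voltage operator;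 $\zeta$ is then a group homomorphism. $\mathcal{X}\rtimes_\eta\mathcal{Y}$ is the $m$-premaniplex with flags $\mathcal{X}\times\mathcal{Y}$ and $(x,y)^i=(\eta(P_{r_i}(y))x,y^i)$. The operator preserves connectivity if $\mathcal{X}'\rtimes_\eta\mathcal{Y}$ is connected for every connected $n$-premaniplex $\mathcal{X}'$. An automorphism $\tilde\tau$ of $\mathcal{X}\rtimes_\eta\mathcal{Y}$ is a lift of $\tau\in\mathrm{Aut}(\mathcal{Y})$ if for every flag $(x,y)$ the second coordinate of $(x,y)\tilde\tau$ is $y\tau$. Standing assumption: $\mathcal{Y}$ has a spanning tree all of whose darts have trivial voltage. -}

module Defs where

open import Data.Nat using (ℕ; _≤_; ∣_-_∣)
open import Data.Fin using (Fin; toℕ)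
open import Data.List using (List; []; _∷_; _++_; reverse)
open import Data.Product using (Σ; ∃; ∃-syntax; _×_; _,_; proj₁; proj₂)
open import Data.Unit using (⊤)
open import Data.Empty using (⊥)
open import Relation.Nullary using (¬_)
open import Relation.Binary.PropositionalEquality using (_≡_)

-- The group C^n, presented by words in the generators r_0,…,r_{n-1}.
-- A word  a₁ ∷ a₂ ∷ … ∷ aₖ ∷ []  stands for  r_{a₁} r_{a₂} ⋯ r_{aₖ};
-- the group product is list concatenation.

Far : {n : ℕ} → Fin n → Fin n → Set
Far i j = 2 ≤ ∣ toℕ i - toℕ j ∣

Word : ℕ → Set
Word n = List (Fin n)

data Rel {n : ℕ} : Word n → Word n → Set where
  invol : (i : Fin n) → Rel (i ∷ i ∷ []) []
  comm  : (i j : Fin n) → Far i j → Rel (i ∷ j ∷ i ∷ j ∷ []) []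

infix 4 _≈_
data _≈_ {n : ℕ} : Word n → Word n → Set where
  ≈-refl  : ∀ {u} → u ≈ u
  ≈-sym   : ∀ {u v} → u ≈ v → v ≈ u
  ≈-trans : ∀ {u v w} → u ≈ v → v ≈ w → u ≈ w
  ≈-rel   : ∀ a {u v} b → Rel u v → (a ++ (u ++ b)) ≈ (a ++ (v ++ b))

-- inverse in C^n (all generators are involutions)
inv : {n : ℕ} → Word n → Word n
inv = reverse

-- Edge-coloured graphs where each vertex has exactly one dart of each
-- colour: x ↦ x^i.  (Semi-edges: adj i x ≡ x.)

record ColGraph (n : ℕ) : Set₁ where
  field
    Flag : Set
    adj  : Fin n → Flag → Flag

open ColGraph public

act : {n : ℕ} (G : ColGraph n) → Word n → Flag G → Flag G
act G []      x = x
act G (a ∷ w) x = adj G a (act G w x)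

Connected : {n : ℕ} → ColGraph n → Set
Connected G = ∀ x y → ∃[ w ] act G w x ≡ y

record Premaniplex (n : ℕ) : Set₁ where
  field
    graph   : ColGraph n
    involut : ∀ i x → adj graph i (adj graph i x) ≡ x
    commut  : ∀ i j x → Far i j →
              adj graph i (adj graph j (adj graph i (adj graph j x))) ≡ x

open Premaniplex public

Stab : {n : ℕ} (G : ColGraph n) → Flag G → Word n → Set
Stab G x w = act G w x ≡ x

record Aut {n : ℕ} (G : ColGraph n) : Set where
  field
    to      : Flag G → Flag G
    from    : Flag G → Flag G
    to-from : ∀ z → to (from z) ≡ z
    from-to : ∀ z → from (to z) ≡ z
    to-adj  : ∀ i z → to (adj G i z) ≡ adj G i (to z)

open Aut public

-- Coset premaniplex C^n / K, for K ≤ C^n given as a predicate on words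
-- (closed under ≈).  Cosets ωK and ω'K coincide iff ω⁻¹ω' ∈ K.

SameCoset : {n : ℕ} → (Word n → Set) → Word n → Word n → Set
SameCoset K ω ω' = K (inv ω ++ ω')

-- X covers C^n/K: there is a surjective homomorphism X → C^n/K,
-- given by a choice of coset representative for each flag.
CoversCoset : {n : ℕ} → Premaniplex n → (Word n → Set) → Set
CoversCoset X K =
  Σ (Flag (graph X) → Word _) λ f →
    (∀ i x → SameCoset K (f (adj (graph X) i x)) (i ∷ f x)) ×
    (∀ ω → ∃[ x ] SameCoset K (f x) ω)

-- Voltage operators.  η y ω = η(P_ω(y)).

record VoltageOp (n m : ℕ) : Set₁ where
  field
    Y      : Premaniplex m
    η      : Flag (graph Y) → Word m → Word n
    η-resp : ∀ y {u v} → u ≈ v → η y u ≈ η y v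
    -- η(W₁W₂) = η(W₂)η(W₁) with W₁ = P_w(y), W₂ = P_{w'}(w y)
    η-comp : ∀ y w' w → η y (w' ++ w) ≈ (η (act (graph Y) w y) w' ++ η y w)

open VoltageOp public

_⋊_ : {n m : ℕ} → Premaniplex n → VoltageOp n m → ColGraph m
Flag (X ⋊ V) = Flag (graph X) × Flag (graph (Y V))
adj  (X ⋊ V) i (x , y) =
  act (graph X) (η V y (i ∷ [])) x , adj (graph (Y V)) i y

PreservesConnectivity : {n m : ℕ} → VoltageOp n m → Set₁
PreservesConnectivity {n} V =
  (X' : Premaniplex n) → Connected (graph X') → Connected (X' ⋊ V)

-- Spanning trees.  A set T of darts (y , i) closed under reversal;
-- walks are colour sequences.

walkEnd : {m : ℕ} (G : ColGraph m) → Flag G → Word m → Flag G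
walkEnd G y []       = y
walkEnd G y (c ∷ cs) = walkEnd G (adj G c y) cs

InT : {m : ℕ} (G : ColGraph m) → (Flag G → Fin m → Set) → Flag G → Word m → Set
InT G T y []       = ⊤
InT G T y (c ∷ cs) = T y c × InT G T (adj G c y) cs

-- no backtracking: consecutive darts are never mutually reverse,
-- i.e. never have the same colour
NoBacktrack : {m : ℕ} → Word m → Set
NoBacktrack []               = ⊤
NoBacktrack (c ∷ [])         = ⊤
NoBacktrack (c ∷ d ∷ cs)     = ¬ (c ≡ d) × NoBacktrack (d ∷ cs)

record SpanningTree {m : ℕ} (G : ColGraph m) : Set₁ where
  field
    T        : Flag G → Fin m → Set
    T-sym    : ∀ y i → T y i → T (adj G i y) i
    spanning : ∀ y y' → ∃[ cs ] (InT G T y cs × walkEnd G y cs ≡ y')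
    acyclic  : ∀ y c cs → InT G T y (c ∷ cs) → NoBacktrack (c ∷ cs) →
               ¬ (walkEnd G y (c ∷ cs) ≡ y)

open SpanningTree public

HasTrivialTree : {n m : ℕ} → VoltageOp n m → Set₁
HasTrivialTree V =
  Σ (SpanningTree (graph (Y V))) λ S →
    ∀ y i → T S y i → η V y (i ∷ []) ≈ []

module _ {n m : ℕ} (V : VoltageOp n m) (y₀ : Flag (graph (Y V))) where

  L : Word m → Set
  L = Stab (graph (Y V)) y₀

  -- λ ∈ L^υ = υ⁻¹ L υ  iff  υ λ υ⁻¹ ∈ L
  Lconj : Word m → Word m → Set
  Lconj υ ℓ = L (υ ++ (ℓ ++ inv υ))

  InNorm : Word m → Set
  InNorm υ = ∀ ℓ → (L ℓ → Lconj υ ℓ) × (Lconj υ ℓ → L ℓ)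

  ζ : Word m → Word n
  ζ ℓ = η V y₀ ℓ

  Kυ : Word m → Word n → Set
  Kυ υ ω = ∃[ ℓ ] (L ℓ × Lconj υ ℓ × ω ≈ ζ ℓ)

IsLift : {n m : ℕ} (X : Premaniplex n) (V : VoltageOp n m) →
         Aut (X ⋊ V) → Aut (graph (Y V)) → Set
IsLift X V φ τ = ∀ x y → proj₂ (to φ (x , y)) ≡ to τ y

-- Preserving connectivity, applied to the universal premaniplex (C^n acting on itself), makes
-- ζ : L → C^n onto.  Let ψ be an automorphism of X ⋊ Y and ψ(x₀, y₀) = υ(x₀, y₀) = (x₁, y₁).
-- Every ℓ ∈ L with ζ(ℓ) ∈ N fixes (x₀, y₀), hence fixes (x₁, y₁), so ℓ ∈ L^{υ⁻¹}; thus N lies in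
-- ζ(L ∩ L^{υ⁻¹}) and X covers Z_{υ⁻¹}.  By hypothesis υ⁻¹ then normalises L, i.e. all of L fixes
-- y₁, and by conjugation the stabiliser of any y fixes the second coordinate of ψ(x, y): that
-- coordinate depends on y alone.  Applied to ψ and ψ⁻¹ this defines the automorphism of Y lifted
-- by ψ.  The universal premaniplex is built on normal forms in the right-angled Coxeter group
-- C^n, recorded by their projections to pairs of adjacent generators.

module Submission where

open import Defs
open import Data.Nat using (ℕ; zero; suc; _+_; _≤_; s≤s; z≤n)
open import Data.Nat.Properties using (+-suc; ∣-∣-comm; suc-injective)
open import Data.Fin using (Fin; toℕ) renaming (zero to fzero; suc to fsuc)
import Data.Fin.Properties as Fin
open import Data.Bool using (Bool; true; false; _∧_)
import Data.Bool.Properties as Bool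
open import Data.List using (List; []; _∷_; _++_; reverse; [_])
import Data.List.Properties as List
open import Data.Vec using (Vec; replicate) renaming ([] to []ᵥ; _∷_ to _∷ᵥ_)
import Data.Vec.Properties as Vec
open import Data.Product using (Σ; ∃-syntax; _×_; _,_; proj₁; proj₂)
open import Data.Sum using (_⊎_; inj₁; inj₂)
open import Data.Unit using (⊤; tt)
open import Data.Empty using (⊥; ⊥-elim)
open import Relation.Nullary using (¬_; Dec; yes; no)
open import Relation.Nullary.Decidable using (True; toWitness; fromWitness)
open import Relation.Binary.PropositionalEquality
  using (_≡_; refl; sym; trans; cong; cong₂; subst; subst₂; module ≡-Reasoning)

private variable n m : ℕ

≈-++ˡ : (a : Word n) {u v : Word n} → u ≈ v → a ++ u ≈ a ++ v
≈-++ˡ a ≈-refl        = ≈-refl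
≈-++ˡ a (≈-sym p)     = ≈-sym (≈-++ˡ a p)
≈-++ˡ a (≈-trans p q) = ≈-trans (≈-++ˡ a p) (≈-++ˡ a q)
≈-++ˡ a (≈-rel a′ {u} {v} b r) =
  subst₂ _≈_ (List.++-assoc a a′ (u ++ b)) (List.++-assoc a a′ (v ++ b)) (≈-rel (a ++ a′) b r)

≈-++ʳ : (c : Word n) {u v : Word n} → u ≈ v → u ++ c ≈ v ++ c
≈-++ʳ c ≈-refl        = ≈-refl
≈-++ʳ c (≈-sym p)     = ≈-sym (≈-++ʳ c p)
≈-++ʳ c (≈-trans p q) = ≈-trans (≈-++ʳ c p) (≈-++ʳ c q)
≈-++ʳ c (≈-rel a {u} {v} b r) = subst₂ _≈_ (reassoc u) (reassoc v) (≈-rel a (b ++ c) r)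
  where
  reassoc : ∀ w → a ++ (w ++ (b ++ c)) ≡ (a ++ (w ++ b)) ++ c
  reassoc w = trans (cong (a ++_) (sym (List.++-assoc w b c))) (sym (List.++-assoc a (w ++ b) c))

≈-∷ : (i : Fin n) {u v : Word n} → u ≈ v → i ∷ u ≈ i ∷ v
≈-∷ i = ≈-++ˡ [ i ]

∷-∷-cancel : (i : Fin n) (w : Word n) → i ∷ i ∷ w ≈ w
∷-∷-cancel i w = ≈-rel [] w (invol i)

inv-inverseˡ : (w : Word n) → inv w ++ w ≈ []
inv-inverseˡ []      = ≈-refl
inv-inverseˡ (a ∷ w) = subst (_≈ []) (sym reassoc) (≈-trans (≈-rel (reverse w) w (invol a)) (inv-inverseˡ w))
  where
  reassoc : inv (a ∷ w) ++ a ∷ w ≡ reverse w ++ (a ∷ a ∷ []) ++ w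
  reassoc = trans (cong (_++ a ∷ w) (List.unfold-reverse a w)) (List.++-assoc (reverse w) [ a ] (a ∷ w))

inv-inverseʳ : (w : Word n) → w ++ inv w ≈ []
inv-inverseʳ w = subst (λ u → u ++ inv w ≈ []) (List.reverse-involutive w) (inv-inverseˡ (inv w))

far-swap : (a c : Fin n) → Far a c → (w : Word n) → a ∷ c ∷ w ≈ c ∷ a ∷ w
far-swap a c far w =
  ≈-trans (≈-sym (≈-rel (a ∷ c ∷ []) w (invol a)))
  (≈-trans (≈-sym (≈-rel (a ∷ c ∷ a ∷ []) (a ∷ w) (invol c)))
  (≈-rel [] (c ∷ a ∷ w) (comm a c far)))

Far-sym : (a c : Fin n) → Far a c → Far c a
Far-sym a c = subst (2 ≤_) (∣-∣-comm (toℕ a) (toℕ c))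

act-++ : (G : ColGraph n) (u v : Word n) (x : Flag G) → act G (u ++ v) x ≡ act G u (act G v x)
act-++ G []      v x = refl
act-++ G (a ∷ u) v x = cong (adj G a) (act-++ G u v x)

-- The trace graph below satisfies the relators only on coherent traces.
module InvariantAction (G : ColGraph n) (Q : Flag G → Set)
  (Q-adj : ∀ i y → Q y → Q (adj G i y))
  (Q-rel : ∀ {u v} → Rel u v → ∀ y → Q y → act G u y ≡ act G v y) where

  Q-act : ∀ w y → Q y → Q (act G w y)
  Q-act []      y q = q
  Q-act (a ∷ w) y q = Q-adj a _ (Q-act w y q)

  act-resp : ∀ {u v} → u ≈ v → ∀ y → Q y → act G u y ≡ act G v y
  act-resp ≈-refl        y q = refl
  act-resp (≈-sym p)     y q = sym (act-resp p y q)
  act-resp (≈-trans p r) y q = trans (act-resp p y q) (act-resp r y q)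
  act-resp (≈-rel a {u} {v} b r) y q = begin
    act G (a ++ u ++ b) y         ≡⟨ act-++ G a (u ++ b) y ⟩
    act G a (act G (u ++ b) y)    ≡⟨ cong (act G a) (act-++ G u b y) ⟩
    act G a (act G u (act G b y)) ≡⟨ cong (act G a) (Q-rel r _ (Q-act b y q)) ⟩
    act G a (act G v (act G b y)) ≡⟨ cong (act G a) (act-++ G v b y) ⟨
    act G a (act G (v ++ b) y)    ≡⟨ act-++ G a (v ++ b) y ⟨
    act G (a ++ v ++ b) y         ∎
    where open ≡-Reasoning

act-resp : (P : Premaniplex n) {u v : Word n} → u ≈ v → ∀ x → act (graph P) u x ≡ act (graph P) v x
act-resp P p x = InvariantAction.act-resp (graph P) (λ _ → ⊤) (λ _ _ _ → tt) relator p x tt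
  where
  relator : ∀ {u v} → Rel u v → ∀ y → ⊤ → act (graph P) u y ≡ act (graph P) v y
  relator (invol i)      y _ = involut P i y
  relator (comm i j far) y _ = commut P i j y far

module _ (P : Premaniplex n) where
  private G = graph P

  act-inv-cancelˡ : ∀ w x → act G (inv w) (act G w x) ≡ x
  act-inv-cancelˡ w x = trans (sym (act-++ G (inv w) w x)) (act-resp P (inv-inverseˡ w) x)

  act-inv-cancelʳ : ∀ w x → act G w (act G (inv w) x) ≡ x
  act-inv-cancelʳ w x = trans (sym (act-++ G w (inv w) x)) (act-resp P (inv-inverseʳ w) x)

  idempotent-acts-trivially : ∀ a x → a ≈ a ++ a → act G a x ≡ x
  idempotent-acts-trivially a x idem = begin
    act G a x                           ≡⟨ act-inv-cancelˡ a (act G a x) ⟨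
    act G (inv a) (act G a (act G a x)) ≡⟨ cong (act G (inv a)) (act-++ G a a x) ⟨
    act G (inv a) (act G (a ++ a) x)    ≡⟨ cong (act G (inv a)) (act-resp P idem x) ⟨
    act G (inv a) (act G a x)           ≡⟨ act-inv-cancelˡ a x ⟩
    x                                   ∎
    where open ≡-Reasoning

act-⋊ : (X : Premaniplex n) (V : VoltageOp n m) (w : Word m) (x : Flag (graph X)) (y : Flag (graph (Y V))) →
  act (X ⋊ V) w (x , y) ≡ (act (graph X) (η V y w) x , act (graph (Y V)) w y)
act-⋊ X V []      x y = cong (_, y) (sym (idempotent-acts-trivially X (η V y []) x (η-comp V y [] [])))
act-⋊ X V (c ∷ w) x y rewrite act-⋊ X V w x y =
  cong (_, _) (sym (trans (act-resp X (η-comp V y [ c ] w) x)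
                          (act-++ (graph X) (η V (act (graph (Y V)) w y) [ c ]) (η V y w) x)))

proj₂-act-⋊ : (X : Premaniplex n) (V : VoltageOp n m) (w : Word m) (z : Flag (X ⋊ V)) →
  proj₂ (act (X ⋊ V) w z) ≡ act (graph (Y V)) w (proj₂ z)
proj₂-act-⋊ X V w (x , y) = cong proj₂ (act-⋊ X V w x y)

Aut-act : {G : ColGraph n} (ψ : Aut G) (w : Word n) (z : Flag G) → to ψ (act G w z) ≡ act G w (to ψ z)
Aut-act ψ []      z = refl
Aut-act {G = G} ψ (a ∷ w) z = trans (to-adj ψ a _) (cong (adj G a) (Aut-act ψ w z))

Aut-inverse : {G : ColGraph n} → Aut G → Aut G
to      (Aut-inverse φ) = from φ
from    (Aut-inverse φ) = to φ
to-from (Aut-inverse φ) = from-to φ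
from-to (Aut-inverse φ) = to-from φ
to-adj  (Aut-inverse {G = G} φ) i z = begin
  from φ (adj G i z)                 ≡⟨ cong (λ u → from φ (adj G i u)) (to-from φ z) ⟨
  from φ (adj G i (to φ (from φ z))) ≡⟨ cong (from φ) (to-adj φ i (from φ z)) ⟨
  from φ (to φ (adj G i (from φ z))) ≡⟨ from-to φ _ ⟩
  adj G i (from φ z)                 ∎
  where open ≡-Reasoning

-- The universal premaniplex

-- An element of C^n is encoded by its n+1 projections: list k is the subword of a reduced
-- word on the letters k-1 (false) and k (true), latest letter first.  Letter i goes to the
-- lists i and i+1, where it is either pushed or, if it is the latest letter of both, cancelled.
Trace : ℕ → Set
Trace n = Vec (List Bool) (suc n)

cancels : List Bool → List Bool → Bool
cancels (true ∷ _) (false ∷ _) = true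
cancels _          _           = false

pushPair : List Bool × List Bool → List Bool × List Bool
pushPair (true ∷ A , false ∷ B) = A , B
pushPair (A , B)                = true ∷ A , false ∷ B

push : Fin n → Trace n → Trace n
push fzero    (A ∷ᵥ B ∷ᵥ r) = proj₁ (pushPair (A , B)) ∷ᵥ proj₂ (pushPair (A , B)) ∷ᵥ r
push (fsuc i) (A ∷ᵥ r)      = A ∷ᵥ push i r

Top : Fin n → Trace n → Set
Top fzero    (A ∷ᵥ B ∷ᵥ r) = cancels A B ≡ true
Top (fsuc i) (A ∷ᵥ r)      = Top i r

-- A necessary condition for A and B to be the projections of one reduced word to {k-1, k} and
-- {k, k+1}: the letters k (true in A, false in B) occur in step, and consecutive ones are
-- separated by a k-1 or a k+1; s records whether such a separator has been read.
compatible : Bool → List Bool → List Bool → Bool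
compatible s (false ∷ A) B           = compatible true A B
compatible s (true ∷ A)  (true ∷ B)  = compatible true (true ∷ A) B
compatible s (true ∷ A)  (false ∷ B) = s ∧ compatible false A B
compatible s (true ∷ A)  []          = true
compatible s []          (true ∷ B)  = compatible true [] B
compatible s []          (false ∷ B) = true
compatible s []          []          = true

Compatible : List Bool × List Bool → Set
Compatible (A , B) = compatible true A B ≡ true

Coherent : ∀ {k} → Vec (List Bool) (suc k) → Set
Coherent (A ∷ᵥ []ᵥ)     = ⊤
Coherent (A ∷ᵥ B ∷ᵥ r) = Compatible (A , B) × Coherent (B ∷ᵥ r)

pushPair-noncancel : ∀ A B → cancels A B ≡ false → pushPair (A , B) ≡ (true ∷ A , false ∷ B)
pushPair-noncancel (true ∷ A)  (false ∷ B) ()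
pushPair-noncancel (true ∷ A)  (true ∷ B)  _ = refl
pushPair-noncancel (true ∷ A)  []          _ = refl
pushPair-noncancel (false ∷ A) B           _ = refl
pushPair-noncancel []          B           _ = refl

compatible-true-headʳ : ∀ s A B → compatible s A (true ∷ B) ≡ compatible true A B
compatible-true-headʳ s (false ∷ A) B = compatible-true-headʳ true A B
compatible-true-headʳ s (true ∷ A)  B = refl
compatible-true-headʳ s []          B = refl

compatible-separated : ∀ A B → compatible false A B ≡ true → compatible true A B ≡ true
compatible-separated (false ∷ A) B           c = c
compatible-separated (true ∷ A)  (true ∷ B)  c = c
compatible-separated (true ∷ A)  (false ∷ B) ()
compatible-separated (true ∷ A)  []          c = c
compatible-separated []          (true ∷ B)  c = c
compatible-separated []          (false ∷ B) c = c
compatible-separated []          []          c = c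

compatible-noncancel : ∀ A B → cancels A B ≡ false → compatible false A B ≡ compatible true A B
compatible-noncancel (false ∷ A) B           _ = refl
compatible-noncancel (true ∷ A)  (true ∷ B)  _ = refl
compatible-noncancel (true ∷ A)  (false ∷ B) ()
compatible-noncancel (true ∷ A)  []          _ = refl
compatible-noncancel []          (true ∷ B)  _ = refl
compatible-noncancel []          (false ∷ B) _ = refl
compatible-noncancel []          []          _ = refl

cancels-unseparated : ∀ A B → cancels A B ≡ true → compatible false A B ≡ false
cancels-unseparated (true ∷ A) (false ∷ B) _ = refl

pushPair-involutive : ∀ A B → Compatible (A , B) → pushPair (pushPair (A , B)) ≡ (A , B)
pushPair-involutive (true ∷ A) (false ∷ B) c with cancels A B in eq
... | true  = ⊥-elim (Bool.not-¬ (cancels-unseparated A B eq) c)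
... | false = pushPair-noncancel A B eq
pushPair-involutive (true ∷ A)  (true ∷ B) _ = refl
pushPair-involutive (true ∷ A)  []         _ = refl
pushPair-involutive (false ∷ A) B          _ = refl
pushPair-involutive []          B          _ = refl

pushPair-compatible : ∀ A B → Compatible (A , B) → Compatible (pushPair (A , B))
pushPair-compatible (true ∷ A)  (false ∷ B) c = compatible-separated A B c
pushPair-compatible (true ∷ A)  (true ∷ B)  c = trans (compatible-noncancel (true ∷ A) (true ∷ B) refl) c
pushPair-compatible (true ∷ A)  []          c = trans (compatible-noncancel (true ∷ A) [] refl) c
pushPair-compatible (false ∷ A) B           c = trans (compatible-noncancel (false ∷ A) B refl) c
pushPair-compatible []          B           c = trans (compatible-noncancel [] B refl) c

compatible-pushPair₂ : ∀ A B C → compatible true (proj₂ (pushPair (A , B))) C ≡ compatible true B C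
compatible-pushPair₂ (true ∷ A)  (false ∷ B) C = refl
compatible-pushPair₂ (true ∷ A)  (true ∷ B)  C = refl
compatible-pushPair₂ (true ∷ A)  []          C = refl
compatible-pushPair₂ (false ∷ A) B           C = refl
compatible-pushPair₂ []          B           C = refl

compatible-pushPair₁ : ∀ A B C → compatible true C (proj₁ (pushPair (A , B))) ≡ compatible true C A
compatible-pushPair₁ (true ∷ A)  (false ∷ B) C = sym (compatible-true-headʳ true C A)
compatible-pushPair₁ (true ∷ A)  (true ∷ B)  C = compatible-true-headʳ true C (true ∷ A)
compatible-pushPair₁ (true ∷ A)  []          C = compatible-true-headʳ true C (true ∷ A)
compatible-pushPair₁ (false ∷ A) B           C = compatible-true-headʳ true C (false ∷ A)
compatible-pushPair₁ []          B           C = compatible-true-headʳ true C []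

push-involutive : (i : Fin n) (P : Trace n) → Coherent P → push i (push i P) ≡ P
push-involutive fzero (A ∷ᵥ B ∷ᵥ r) (c , _) =
  cong₂ (λ A′ B′ → A′ ∷ᵥ B′ ∷ᵥ r) (cong proj₁ (pushPair-involutive A B c)) (cong proj₂ (pushPair-involutive A B c))
push-involutive (fsuc i) (A ∷ᵥ B ∷ᵥ r) (_ , cs) = cong (A ∷ᵥ_) (push-involutive i (B ∷ᵥ r) cs)

push-coherent : (i : Fin n) (P : Trace n) → Coherent P → Coherent (push i P)
push-coherent fzero (A ∷ᵥ B ∷ᵥ []ᵥ) (c , _) = pushPair-compatible A B c , tt
push-coherent fzero (A ∷ᵥ B ∷ᵥ C ∷ᵥ r) (c , c′ , cs) =
  pushPair-compatible A B c , trans (compatible-pushPair₂ A B C) c′ , cs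
push-coherent (fsuc fzero) (A ∷ᵥ B ∷ᵥ C ∷ᵥ r) (c , cs) =
  trans (compatible-pushPair₁ B C A) c , push-coherent fzero (B ∷ᵥ C ∷ᵥ r) cs
push-coherent (fsuc (fsuc i)) (A ∷ᵥ B ∷ᵥ r) (c , cs) = c , push-coherent (fsuc i) (B ∷ᵥ r) cs

push-comm : (i j : Fin n) → Far i j → (P : Trace n) → push i (push j P) ≡ push j (push i P)
push-comm fzero           (fsuc (fsuc j)) _ (A ∷ᵥ B ∷ᵥ r) = refl
push-comm (fsuc (fsuc i)) fzero           _ (A ∷ᵥ B ∷ᵥ r) = refl
push-comm (fsuc i)        (fsuc j)      far (A ∷ᵥ r)      = cong (A ∷ᵥ_) (push-comm i j far r)
push-comm fzero           fzero           ()
push-comm fzero           (fsuc fzero)    (s≤s ())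
push-comm (fsuc fzero)    fzero           (s≤s ())

Top-push-far : (a c : Fin n) → Far a c → (P : Trace n) → Top c P → Top c (push a P)
Top-push-far fzero           (fsuc (fsuc c)) _ (A ∷ᵥ B ∷ᵥ r) t = t
Top-push-far (fsuc (fsuc a)) fzero           _ (A ∷ᵥ B ∷ᵥ r) t = t
Top-push-far (fsuc a)        (fsuc c)      far (A ∷ᵥ r)      t = Top-push-far a c far r t
Top-push-far fzero           fzero           ()
Top-push-far fzero           (fsuc fzero)    (s≤s ())
Top-push-far (fsuc fzero)    fzero           (s≤s ())

adjacent-not-both-top : ∀ A B C → cancels A B ≡ true → cancels B C ≡ true → ⊥
adjacent-not-both-top (true ∷ A) (false ∷ B) C _ ()

Top-equal-or-far : (a c : Fin n) (P : Trace n) → Top a P → Top c P → a ≡ c ⊎ Far a c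
Top-equal-or-far fzero           fzero           P                  _  _  = inj₁ refl
Top-equal-or-far fzero           (fsuc (fsuc c)) P                  _  _  = inj₂ (s≤s (s≤s z≤n))
Top-equal-or-far (fsuc (fsuc a)) fzero           P                  _  _  = inj₂ (s≤s (s≤s z≤n))
Top-equal-or-far fzero           (fsuc fzero)    (A ∷ᵥ B ∷ᵥ C ∷ᵥ r) ta tc = ⊥-elim (adjacent-not-both-top A B C ta tc)
Top-equal-or-far (fsuc fzero)    fzero           (A ∷ᵥ B ∷ᵥ C ∷ᵥ r) ta tc = ⊥-elim (adjacent-not-both-top A B C tc ta)
Top-equal-or-far (fsuc a)        (fsuc c)        (A ∷ᵥ r)           ta tc with Top-equal-or-far a c r ta tc
... | inj₁ refl = inj₁ refl
... | inj₂ far  = inj₂ far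

Top-push : (a : Fin n) (P : Trace n) → ¬ Top a P → Top a (push a P)
Top-push fzero    (A ∷ᵥ B ∷ᵥ r) ¬t rewrite pushPair-noncancel A B (Bool.¬-not ¬t) = refl
Top-push (fsuc a) (A ∷ᵥ r)      ¬t = Top-push a r ¬t

Top? : (a : Fin n) (P : Trace n) → Dec (Top a P)
Top? fzero    (A ∷ᵥ B ∷ᵥ r) = cancels A B Bool.≟ true
Top? (fsuc a) (A ∷ᵥ r)      = Top? a r

findTop : (P : Trace n) → ∃[ a ] Top a P ⊎ (∀ a → ¬ Top a P)
findTop {zero}  P = inj₂ λ ()
findTop {suc n} (A ∷ᵥ B ∷ᵥ r) with Top? fzero (A ∷ᵥ B ∷ᵥ r) | findTop (B ∷ᵥ r)
... | yes t | _            = inj₁ (fzero , t)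
... | no ¬t | inj₁ (a , t) = inj₁ (fsuc a , t)
... | no ¬t | inj₂ none    = inj₂ λ { fzero t → ¬t t ; (fsuc a) t → none a t }

trues : List Bool → ℕ
trues []          = 0
trues (true ∷ A)  = suc (trues A)
trues (false ∷ A) = trues A

-- the length of the encoded reduced word
size : ∀ {k} → Vec (List Bool) k → ℕ
size []ᵥ       = 0
size (A ∷ᵥ r) = trues A + size r

size-cancel : (a : Fin n) (P : Trace n) → Top a P → suc (size (push a P)) ≡ size P
size-cancel fzero    ((true ∷ A) ∷ᵥ (false ∷ B) ∷ᵥ r) _ = refl
size-cancel (fsuc a) (A ∷ᵥ r) t = trans (sym (+-suc (trues A) _)) (cong (trues A +_) (size-cancel a r t))

size-push : (a : Fin n) (P : Trace n) → ¬ Top a P → size (push a P) ≡ suc (size P)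
size-push fzero    (A ∷ᵥ B ∷ᵥ r) ¬t rewrite pushPair-noncancel A B (Bool.¬-not ¬t) = refl
size-push (fsuc a) (A ∷ᵥ r)      ¬t = trans (cong (trues A +_) (size-push a r ¬t)) (+-suc (trues A) _)

readOff : ℕ → Trace n → Word n
readOff zero    P = []
readOff (suc k) P with findTop P
... | inj₁ (a , _) = a ∷ readOff k (push a P)
... | inj₂ _       = []

readOff-top : ∀ k (P : Trace n) c → size P ≡ suc k → Top c P → readOff (suc k) P ≈ c ∷ readOff k (push c P)
readOff-top k P c size≡ tc with findTop P
... | inj₂ none = ⊥-elim (none c tc)
... | inj₁ (a , ta) with Top-equal-or-far a c P ta tc
...   | inj₁ refl = ≈-refl
...   | inj₂ far  = swap k (suc-injective (trans (size-cancel a P ta) size≡))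
                           (suc-injective (trans (size-cancel c P tc) size≡))
  where
  tc′ : Top c (push a P)
  tc′ = Top-push-far a c far P tc
  ta′ : Top a (push c P)
  ta′ = Top-push-far c a (Far-sym a c far) P ta
  -- both sides continue with the common word obtained by cancelling a and c
  swap : ∀ k → size (push a P) ≡ k → size (push c P) ≡ k → a ∷ readOff k (push a P) ≈ c ∷ readOff k (push c P)
  swap zero    sa _ with () ← trans (sym sa) (sym (size-cancel c (push a P) tc′))
  swap (suc k) sa sc =
    ≈-trans (≈-∷ a (readOff-top k (push a P) c sa tc′))
    (≈-trans (far-swap a c far _)
    (≈-∷ c (≈-sym (subst (λ Q → readOff (suc k) (push c P) ≈ a ∷ readOff k Q)
                         (push-comm a c far P) (readOff-top k (push c P) a sc ta′)))))

normalWord : Trace n → Word n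
normalWord P = readOff (size P) P

normalWord-push : (i : Fin n) (P : Trace n) → Coherent P → normalWord (push i P) ≈ i ∷ normalWord P
normalWord-push i P coh with Top? i P
... | yes t = ≈-sym (≈-trans (≈-∷ i unpush) (∷-∷-cancel i _))
  where
  unpush : normalWord P ≈ i ∷ normalWord (push i P)
  unpush = subst (λ k → readOff k P ≈ i ∷ normalWord (push i P)) (size-cancel i P t)
                 (readOff-top (size (push i P)) P i (sym (size-cancel i P t)) t)
... | no ¬t =
  subst (λ k → readOff k (push i P) ≈ i ∷ normalWord P) (sym (size-push i P ¬t))
    (subst (λ Q → readOff (suc (size P)) (push i P) ≈ i ∷ readOff (size P) Q) (push-involutive i P coh)
      (readOff-top (size P) (push i P) i (size-push i P ¬t) (Top-push i P ¬t)))

TraceGraph : (n : ℕ) → ColGraph n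
Flag (TraceGraph n) = Trace n
adj  (TraceGraph n) = push

empty : Trace n
empty = replicate _ []

empty-coherent : Coherent (empty {n})
empty-coherent {zero}  = tt
empty-coherent {suc n} = refl , empty-coherent {n}

size-empty : ∀ {k} → size (replicate k ([] {A = Bool})) ≡ 0
size-empty {zero}  = refl
size-empty {suc k} = size-empty {k}

normalWord-empty : normalWord (empty {n}) ≡ []
normalWord-empty {n} = cong (λ k → readOff k (empty {n})) (size-empty {suc n})

push-relator : {u v : Word n} → Rel u v → ∀ P → Coherent P → act (TraceGraph n) u P ≡ act (TraceGraph n) v P
push-relator (invol i) P coh = push-involutive i P coh
push-relator (comm i j far) P coh = begin
  push i (push j (push i (push j P))) ≡⟨ cong (push i) (push-comm i j far (push j P)) ⟨
  push i (push i (push j (push j P))) ≡⟨ push-involutive i _ (push-coherent j _ (push-coherent j P coh)) ⟩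
  push j (push j P)                   ≡⟨ push-involutive j P coh ⟩
  P                                   ∎
  where open ≡-Reasoning

module TraceAction {n : ℕ} = InvariantAction (TraceGraph n) Coherent push-coherent push-relator

-- A trace is admissible when it is reached from the empty trace by its own normal word; this is
-- decidable, so the admissibility proofs below are irrelevant.
admissible? : (P : Trace n) → Dec (act (TraceGraph n) (normalWord P) empty ≡ P)
admissible? P = Vec.≡-dec (List.≡-dec Bool._≟_) _ P

admissible-coherent : (P : Trace n) → act (TraceGraph n) (normalWord P) empty ≡ P → Coherent P
admissible-coherent P reach = subst Coherent reach (TraceAction.Q-act (normalWord P) empty empty-coherent)

admissible-push : (i : Fin n) (P : Trace n) → act (TraceGraph n) (normalWord P) empty ≡ P →
  act (TraceGraph n) (normalWord (push i P)) empty ≡ push i P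
admissible-push i P reach =
  trans (TraceAction.act-resp (normalWord-push i P (admissible-coherent P reach)) empty empty-coherent)
        (cong (push i) reach)

UFlag : ℕ → Set
UFlag n = Σ (Trace n) λ P → True (admissible? P)

UFlag-≡ : {P Q : Trace n} → P ≡ Q → (g : True (admissible? P)) (h : True (admissible? Q)) →
  _≡_ {A = UFlag n} (P , g) (Q , h)
UFlag-≡ {P = P} refl g h = cong (P ,_) (Bool.T-irrelevant g h)

UGraph : (n : ℕ) → ColGraph n
Flag (UGraph n) = UFlag n
adj  (UGraph n) i (P , g) = push i P , fromWitness (admissible-push i P (toWitness g))

Universal : (n : ℕ) → Premaniplex n
graph   (Universal n) = UGraph n
involut (Universal n) i (P , g) = UFlag-≡ (push-involutive i P (admissible-coherent P (toWitness g))) _ g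
commut  (Universal n) i j (P , g) far =
  UFlag-≡ (push-relator (comm i j far) P (admissible-coherent P (toWitness g))) _ g

act-UGraph : (w : Word n) (s : UFlag n) → proj₁ (act (UGraph n) w s) ≡ act (TraceGraph n) w (proj₁ s)
act-UGraph []      s = refl
act-UGraph (a ∷ w) s = cong (push a) (act-UGraph w s)

ubase : UFlag n
ubase {n} = empty , fromWitness (cong (λ w → act (TraceGraph n) w empty) normalWord-empty)

Universal-connected : Connected (UGraph n)
Universal-connected {n} (P , g) (Q , h) = normalWord Q ++ inv (normalWord P) , UFlag-≡ reach _ h
  where
  open ≡-Reasoning
  G : ColGraph n
  G = TraceGraph n
  reach : proj₁ (act (UGraph n) (normalWord Q ++ inv (normalWord P)) (P , g)) ≡ Q
  reach = begin
    proj₁ (act (UGraph n) (normalWord Q ++ inv (normalWord P)) (P , g))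
      ≡⟨ act-UGraph (normalWord Q ++ inv (normalWord P)) (P , g) ⟩
    act G (normalWord Q ++ inv (normalWord P)) P
      ≡⟨ act-++ G (normalWord Q) (inv (normalWord P)) P ⟩
    act G (normalWord Q) (act G (inv (normalWord P)) P)
      ≡⟨ cong (λ R → act G (normalWord Q) (act G (inv (normalWord P)) R)) (toWitness g) ⟨
    act G (normalWord Q) (act G (inv (normalWord P)) (act G (normalWord P) empty))
      ≡⟨ cong (act G (normalWord Q)) (act-++ G (inv (normalWord P)) (normalWord P) empty) ⟨
    act G (normalWord Q) (act G (inv (normalWord P) ++ normalWord P) empty)
      ≡⟨ cong (act G (normalWord Q)) (TraceAction.act-resp (inv-inverseˡ (normalWord P)) empty empty-coherent) ⟩
    act G (normalWord Q) empty
      ≡⟨ toWitness h ⟩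
    Q ∎

normalWord-act : (w : Word n) → normalWord (act (TraceGraph n) w empty) ≈ w
normalWord-act []      = subst (_≈ []) (sym normalWord-empty) ≈-refl
normalWord-act (a ∷ w) =
  ≈-trans (normalWord-push a _ (TraceAction.Q-act w empty empty-coherent)) (≈-∷ a (normalWord-act w))

Universal-faithful : (u v : Word n) → act (UGraph n) u ubase ≡ act (UGraph n) v ubase → u ≈ v
Universal-faithful {n} u v same =
  ≈-trans (≈-sym (normalWord-act u)) (subst (λ P → normalWord P ≈ v) traces≡ (normalWord-act v))
  where
  traces≡ : act (TraceGraph n) v empty ≡ act (TraceGraph n) u empty
  traces≡ = trans (sym (act-UGraph v ubase)) (trans (cong proj₁ (sym same)) (act-UGraph u ubase))

ζ-surjective : (V : VoltageOp n m) → PreservesConnectivity V → (y₀ : Flag (graph (Y V))) →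
  ∀ ν → ∃[ ℓ ] (L V y₀ ℓ × ζ V y₀ ℓ ≈ ν)
ζ-surjective {n} V pc y₀ ν with pc (Universal n) Universal-connected (ubase , y₀) (act (UGraph n) ν ubase , y₀)
... | ℓ , reach = ℓ , cong proj₂ reach′ , Universal-faithful _ ν (cong proj₁ reach′)
  where reach′ = trans (sym (act-⋊ (Universal n) V ℓ ubase y₀)) reach

-- Spanning trees

-- Every walk in the tree reduces to one without backtracking, and only the empty one is closed.
module _ {m : ℕ} (P : Premaniplex m) (S : SpanningTree (graph P)) where
  private
    G = graph P

    Reduced : Flag G → Flag G → Word m → Set
    Reduced y y′ cs = InT G (T S) y cs × walkEnd G y cs ≡ y′ × NoBacktrack cs

    prepend : Fin m → Word m → Word m
    prepend c []       = [ c ]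
    prepend c (d ∷ ds) with c Fin.≟ d
    ... | yes _ = ds
    ... | no  _ = c ∷ d ∷ ds

    NoBacktrack-tail : ∀ (c : Fin m) ds → NoBacktrack (c ∷ ds) → NoBacktrack ds
    NoBacktrack-tail c []       _       = tt
    NoBacktrack-tail c (d ∷ ds) (_ , nb) = nb

    prepend-reduced : ∀ y y′ c ds → T S y c → Reduced (adj G c y) y′ ds → Reduced y y′ (prepend c ds)
    prepend-reduced y y′ c []       t (_ , end , _) = (t , tt) , end , tt
    prepend-reduced y y′ c (d ∷ ds) t (it , end , nb) with c Fin.≟ d
    ... | yes refl = subst (λ z → InT G (T S) z ds) (involut P c y) (proj₂ it)
                   , subst (λ z → walkEnd G z ds ≡ y′) (involut P c y) end
                   , NoBacktrack-tail c ds nb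
    ... | no c≢d   = (t , it) , end , (c≢d , nb)

    reduce : ∀ y y′ cs → InT G (T S) y cs → walkEnd G y cs ≡ y′ → Σ (Word m) (Reduced y y′)
    reduce y y′ []       _        end = [] , tt , end , tt
    reduce y y′ (c ∷ cs) (t , it) end with reduce (adj G c y) y′ cs it end
    ... | ds , red = prepend c ds , prepend-reduced y y′ c ds t red

  spanningTree-≟ : (y y′ : Flag G) → Dec (y ≡ y′)
  spanningTree-≟ y y′ with spanning S y y′
  ... | cs , it , end with reduce y y′ cs it end
  ...   | []       , _         , end′ , _  = yes end′
  ...   | (c ∷ ds) , it′       , end′ , nb = no λ y≡y′ → acyclic S y c ds it′ nb (trans end′ (sym y≡y′))

-- Lifting automorphisms

covers-coset : (X : Premaniplex n) (x₀ : Flag (graph X)) → Connected (graph X) → (K : Word n → Set) →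
  (∀ ν → Stab (graph X) x₀ ν → K ν) → CoversCoset X K
covers-coset {n} X x₀ connX K Stab⊆K = f , f-adj , f-onto
  where
  G = graph X
  f : Flag G → Word n
  f x = proj₁ (connX x₀ x)
  f-reaches : ∀ x → act G (f x) x₀ ≡ x
  f-reaches x = proj₂ (connX x₀ x)
  back : ∀ x ω → act G ω x₀ ≡ x → K (inv (f x) ++ ω)
  back x ω ωx₀ = Stab⊆K _ (begin
    act G (inv (f x) ++ ω) x₀     ≡⟨ act-++ G (inv (f x)) ω x₀ ⟩
    act G (inv (f x)) (act G ω x₀) ≡⟨ cong (act G (inv (f x))) (trans ωx₀ (sym (f-reaches x))) ⟩
    act G (inv (f x)) (act G (f x) x₀) ≡⟨ act-inv-cancelˡ X (f x) x₀ ⟩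
    x₀                            ∎)
    where open ≡-Reasoning
  f-adj : ∀ i x → SameCoset K (f (adj G i x)) (i ∷ f x)
  f-adj i x = back (adj G i x) (i ∷ f x) (cong (adj G i) (f-reaches x))
  f-onto : ∀ ω → ∃[ x ] SameCoset K (f x) ω
  f-onto ω = act G ω x₀ , back (act G ω x₀) ω refl

module _ {n m : ℕ} (V : VoltageOp n m) (y₀ : Flag (graph (Y V))) (υ : Word m) {y₁ : Flag (graph (Y V))}
  (υy₀ : act (graph (Y V)) υ y₀ ≡ y₁) where
  private
    G = graph (Y V)

    act-conjugate : ∀ ℓ → act G (inv υ ++ ℓ ++ inv (inv υ)) y₀ ≡ act G (inv υ) (act G ℓ y₁)
    act-conjugate ℓ = begin
      act G (inv υ ++ ℓ ++ inv (inv υ)) y₀ ≡⟨ cong (λ u → act G (inv υ ++ ℓ ++ u) y₀) (List.reverse-involutive υ) ⟩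
      act G (inv υ ++ ℓ ++ υ) y₀           ≡⟨ act-++ G (inv υ) (ℓ ++ υ) y₀ ⟩
      act G (inv υ) (act G (ℓ ++ υ) y₀)    ≡⟨ cong (act G (inv υ)) (act-++ G ℓ υ y₀) ⟩
      act G (inv υ) (act G ℓ (act G υ y₀)) ≡⟨ cong (λ y → act G (inv υ) (act G ℓ y)) υy₀ ⟩
      act G (inv υ) (act G ℓ y₁)           ∎
      where open ≡-Reasoning

  fixes⇒Lconj : ∀ ℓ → act G ℓ y₁ ≡ y₁ → Lconj V y₀ (inv υ) ℓ
  fixes⇒Lconj ℓ fix = trans (act-conjugate ℓ)
    (trans (cong (act G (inv υ)) (trans fix (sym υy₀))) (act-inv-cancelˡ (Y V) υ y₀))

  Lconj⇒fixes : ∀ ℓ → Lconj V y₀ (inv υ) ℓ → act G ℓ y₁ ≡ y₁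
  Lconj⇒fixes ℓ conj = begin
    act G ℓ y₁                                     ≡⟨ act-inv-cancelʳ (Y V) υ _ ⟨
    act G υ (act G (inv υ) (act G ℓ y₁))           ≡⟨ cong (act G υ) (act-conjugate ℓ) ⟨
    act G υ (act G (inv υ ++ ℓ ++ inv (inv υ)) y₀) ≡⟨ cong (act G υ) conj ⟩
    act G υ y₀                                     ≡⟨ υy₀ ⟩
    y₁                                             ∎
    where open ≡-Reasoning

module Lifting {n m : ℕ} (X : Premaniplex n) (x₀ : Flag (graph X)) (V : VoltageOp n m)
  (connected : Connected (X ⋊ V)) (y₀ : Flag (graph (Y V))) where
  private
    Z  = X ⋊ V
    GY = graph (Y V)

    proj₂-reach : ∀ w {z z′} → act Z w z ≡ z′ → act GY w (proj₂ z) ≡ proj₂ z′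
    proj₂-reach w {z} reach = trans (sym (proj₂-act-⋊ X V w z)) (cong proj₂ reach)

  FibrePreserving : Aut Z → Set
  FibrePreserving ψ = ∀ x x′ y → proj₂ (to ψ (x , y)) ≡ proj₂ (to ψ (x′ , y))

  lift-of-fibrePreserving : (φ : Aut Z) → FibrePreserving φ → FibrePreserving (Aut-inverse φ) →
    ∃[ τ ] IsLift X V φ τ
  lift-of-fibrePreserving φ preserving preserving⁻¹ = τ , λ x y → preserving x x₀ y
    where
    τ : Aut GY
    to      τ y   = proj₂ (to φ (x₀ , y))
    from    τ y   = proj₂ (from φ (x₀ , y))
    to-from τ y   = trans (preserving x₀ _ _) (cong proj₂ (to-from φ (x₀ , y)))
    from-to τ y   = trans (preserving⁻¹ x₀ _ _) (cong proj₂ (from-to φ (x₀ , y)))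
    to-adj  τ i y = trans (preserving x₀ _ _) (cong proj₂ (to-adj φ i (x₀ , y)))

  module _ (ψ : Aut Z) where
    y₁ : Flag GY
    y₁ = proj₂ (to ψ (x₀ , y₀))

    proj₂-Aut-act : ∀ w z → proj₂ (to ψ (act Z w z)) ≡ act GY w (proj₂ (to ψ z))
    proj₂-Aut-act w z = trans (cong proj₂ (Aut-act ψ w z)) (proj₂-act-⋊ X V w (to ψ z))

    L-fixes⇒fibrePreserving : (∀ ℓ → L V y₀ ℓ → act GY ℓ y₁ ≡ y₁) → FibrePreserving ψ
    L-fixes⇒fibrePreserving L-fixes x x′ y = begin
      proj₂ (to ψ (x , y))            ≡⟨ at-x ⟩
      act GY g y₁                     ≡⟨ w-fixes ⟨
      act GY w (act GY g y₁)          ≡⟨ cong (act GY w) at-x ⟨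
      act GY w (proj₂ (to ψ (x , y))) ≡⟨ proj₂-Aut-act w (x , y) ⟨
      proj₂ (to ψ (act Z w (x , y)))  ≡⟨ cong (λ z → proj₂ (to ψ z)) (proj₂ (connected (x , y) (x′ , y))) ⟩
      proj₂ (to ψ (x′ , y))           ∎
      where
      open ≡-Reasoning
      g = proj₁ (connected (x₀ , y₀) (x , y))
      w = proj₁ (connected (x , y) (x′ , y))
      gy₀ : act GY g y₀ ≡ y
      gy₀ = proj₂-reach g (proj₂ (connected (x₀ , y₀) (x , y)))
      wy : act GY w y ≡ y
      wy = proj₂-reach w (proj₂ (connected (x , y) (x′ , y)))
      at-x : proj₂ (to ψ (x , y)) ≡ act GY g y₁
      at-x = trans (cong (λ z → proj₂ (to ψ z)) (sym (proj₂ (connected (x₀ , y₀) (x , y))))) (proj₂-Aut-act g _)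
      conjugate-in-L : L V y₀ (inv g ++ w ++ g)
      conjugate-in-L = begin
        act GY (inv g ++ w ++ g) y₀             ≡⟨ act-++ GY (inv g) (w ++ g) y₀ ⟩
        act GY (inv g) (act GY (w ++ g) y₀)     ≡⟨ cong (act GY (inv g)) (act-++ GY w g y₀) ⟩
        act GY (inv g) (act GY w (act GY g y₀)) ≡⟨ cong (λ y′ → act GY (inv g) (act GY w y′)) gy₀ ⟩
        act GY (inv g) (act GY w y)             ≡⟨ cong (act GY (inv g)) (trans wy (sym gy₀)) ⟩
        act GY (inv g) (act GY g y₀)            ≡⟨ act-inv-cancelˡ (Y V) g y₀ ⟩
        y₀                                      ∎
      w-fixes : act GY w (act GY g y₁) ≡ act GY g y₁
      w-fixes = begin
        act GY w (act GY g y₁)                 ≡⟨ act-inv-cancelʳ (Y V) g _ ⟨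
        act GY g (act GY (inv g) (act GY w (act GY g y₁)))
          ≡⟨ cong (act GY g) (trans (act-++ GY (inv g) (w ++ g) y₁) (cong (act GY (inv g)) (act-++ GY w g y₁))) ⟨
        act GY g (act GY (inv g ++ w ++ g) y₁) ≡⟨ cong (act GY g) (L-fixes (inv g ++ w ++ g) conjugate-in-L) ⟩
        act GY g y₁                            ∎

    υ : Word m
    υ = proj₁ (connected (x₀ , y₀) (to ψ (x₀ , y₀)))

    υy₀ : act GY υ y₀ ≡ y₁
    υy₀ = proj₂-reach υ (proj₂ (connected (x₀ , y₀) (to ψ (x₀ , y₀))))

    L∩ζ⁻¹N-fixes : ∀ ℓ → L V y₀ ℓ → Stab (graph X) x₀ (ζ V y₀ ℓ) → act GY ℓ y₁ ≡ y₁
    L∩ζ⁻¹N-fixes ℓ ℓy₀ ζℓx₀ = begin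
      act GY ℓ y₁                      ≡⟨ proj₂-Aut-act ℓ (x₀ , y₀) ⟨
      proj₂ (to ψ (act Z ℓ (x₀ , y₀))) ≡⟨ cong (λ z → proj₂ (to ψ z)) ℓ-fixes-base ⟩
      y₁                               ∎
      where
      open ≡-Reasoning
      ℓ-fixes-base : act Z ℓ (x₀ , y₀) ≡ (x₀ , y₀)
      ℓ-fixes-base = trans (act-⋊ X V ℓ x₀ y₀) (cong₂ _,_ ζℓx₀ ℓy₀)

    N⊆K : PreservesConnectivity V → ∀ ν → Stab (graph X) x₀ ν → Kυ V y₀ (inv υ) ν
    N⊆K pc ν νx₀ with ζ-surjective V pc y₀ ν
    ... | ℓ , ℓy₀ , ζℓ≈ν =
      ℓ , ℓy₀ , fixes⇒Lconj V y₀ υ υy₀ ℓ (L∩ζ⁻¹N-fixes ℓ ℓy₀ (trans (act-resp X ζℓ≈ν x₀) νx₀)) , ≈-sym ζℓ≈ν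

    -- The hypothesis only refutes that some ℓ ∈ L moves y₁; decidability of flag equality
    -- turns this refutation into a proof.
    L-fixes : Connected (graph X) → PreservesConnectivity V → ((y y′ : Flag GY) → Dec (y ≡ y′)) →
      (∀ υ → ¬ InNorm V y₀ υ → ¬ CoversCoset X (Kυ V y₀ υ)) →
      ∀ ℓ → L V y₀ ℓ → act GY ℓ y₁ ≡ y₁
    L-fixes connX pc _≟_ no-cover ℓ ℓy₀ with act GY ℓ y₁ ≟ y₁
    ... | yes fix = fix
    ... | no ¬fix = ⊥-elim (no-cover (inv υ) not-normal (covers-coset X x₀ connX _ (N⊆K pc)))
      where
      not-normal : ¬ InNorm V y₀ (inv υ)
      not-normal normal = ¬fix (Lconj⇒fixes V y₀ υ υy₀ ℓ (proj₁ (normal ℓ) ℓy₀))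

theorem6p10 : {n m : ℕ} (X : Premaniplex n) (x₀ : Flag (graph X)) →
    Connected (graph X) →
    (V : VoltageOp n m) → HasTrivialTree V → PreservesConnectivity V →
    (y₀ : Flag (graph (Y V))) →
    (∀ υ → ¬ InNorm V y₀ υ → ¬ CoversCoset X (Kυ V y₀ υ)) →
    (φ : Aut (X ⋊ V)) → ∃[ τ ] IsLift X V φ τ
theorem6p10 X x₀ connX V (tree , _) pc y₀ no-cover φ =
  lift-of-fibrePreserving φ (preserving φ) (preserving (Aut-inverse φ))
  where
  open Lifting X x₀ V (pc X connX) y₀
  preserving : (ψ : Aut (X ⋊ V)) → FibrePreserving ψ
  preserving ψ = L-fixes⇒fibrePreserving ψ (L-fixes ψ connX pc (spanningTree-≟ (Y V) tree) no-cover)
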